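{- Let $f\ge 2$, $r\ge 0$, $k\ge 1$ with $f+r\ge 3$. Then $(\mathcal P^r_{f,k},\preceq)$ is a non-empty finite poset, and $(\mathcal R^r_{f,k},\preceq)$ is a subposet of it.
   Context: A diagram of length $n$ is a simple graph on sites $\{1,\dots,n\}$ whose edges (arcs) are pairs $(s_1,s_2)$ with $s_1<s_2$ and $1<s_2-s_1<n-1$, supported by $s_1,s_2$. A diagram is binary if it has at least one arc and each site supports at most one arc. A site is free if it supports no arc; $s$ is covered by $(s_1,s_2)$ if $s_1<s<s_2$. Arcs $(s_1,s_2),(s_1',s_2')$ cross if $s_1<s_1'<s_2<s_2'$ or $s_1'<s_1<s_2'<s_2$; a diagram is $k$-noncrossing if it has no $k+1$ pairwise crossing arcs. A diagram is proper if it is binary, each arc covers at least one free site, and no arc covers all free sites. If $u_1<\dots<u_f$ are the free sites, $u_0=0$, $u_{f+1}=n+1$, the $i$-th block $B_i$ is the set of sites $s$ with $u_{i-1}<s<u_i$. The block matrix $\mathbf B(S)=(b_{i,j})$ is the symmetric $(f+1)\times(f+1)$ matrix where, for $i\ne j$, $b_{i,j}$ is the number of arcs with one supporting site in $B_i$ and the other in $B_j$, and $b_{i,i}$ is the number of arcs with both supporting sites in $B_i$. The tautology number of $S$ is $\sum_{i<j}\max\{0,b_{i,j}-1\}+\sum_{i}b_{i,i+1}$. A diagram is regular if it is binary and no two crossing arcs have supporting sites lying in a common block. $\mathcal P^r_{f,k}$ is the set of proper $k$-noncrossing diagrams with exactly $f$ free sites and tautology number at most $r$; $\mathcal R^r_{f,k}$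 is its subset of regular diagrams. Suppressing an arc of a binary diagram deletes the arc and its two supporting sites and relabels the remaining sites consecutively in order; $S\preceq S'$ means $S$ is obtained from $S'$ by a (possibly empty) sequence of arc suppressions. -}

module Defs where

open import Data.Nat using (ℕ; zero; suc; _+_; _∸_; _≤_; _<_; _≡ᵇ_; _<ᵇ_)
open import Data.Bool using (Bool; _∧_; _∨_; not)
open import Data.List using (List; []; length; map; upTo; concatMap; filterᵇ)
open import Data.Nat.ListAction using (sum)
open import Data.List.Membership.Propositional using (_∈_)
open import Data.List.Relation.Unary.AllPairs using (AllPairs)
open import Data.List.Relation.Unary.All using (All)
open import Data.Product using (Σ; ∃; _×_; _,_; proj₁; proj₂)
open import Data.Sum using (_⊎_)
open import Relation.Binary.PropositionalEquality using (_≡_; _≢_)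
open import Relation.Binary.Construct.Closure.ReflexiveTransitive using (Star)

-- An arc (s₁ , s₂) with s₁ < s₂ ; sites are numbered 1 … len.
Arc : Set
Arc = ℕ × ℕ

-- A diagram: its length and its set of arcs, stored as a strictly
-- lexicographically increasing list (canonical representation of a finite set).
record Diagram : Set where
  constructor mkD
  field
    len  : ℕ
    arcs : List Arc
open Diagram public

_<lex_ : Arc → Arc → Set
(a , b) <lex (c , d) = a < c ⊎ (a ≡ c × b < d)

ArcOK : ℕ → Arc → Set
ArcOK n (a , b) = 1 ≤ a × a < b × b ≤ n × 1 < b ∸ a × b ∸ a < n ∸ 1

IsDiagram : Diagram → Set
IsDiagram D = AllPairs _<lex_ (arcs D) × All (ArcOK (len D)) (arcs D)

supportsᵇ : ℕ → Arc → Bool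
supportsᵇ s (a , b) = (s ≡ᵇ a) ∨ (s ≡ᵇ b)

Supports : ℕ → Arc → Set
Supports s (a , b) = s ≡ a ⊎ s ≡ b

deg : Diagram → ℕ → ℕ
deg D s = length (filterᵇ (supportsᵇ s) (arcs D))

IsBinary : Diagram → Set
IsBinary D = IsDiagram D × arcs D ≢ [] × (∀ s → deg D s ≤ 1)

sites : ℕ → List ℕ
sites n = map suc (upTo n)

IsFree : Diagram → ℕ → Set
IsFree D s = 1 ≤ s × s ≤ len D × deg D s ≡ 0

freeSites : Diagram → List ℕ
freeSites D = filterᵇ (λ s → deg D s ≡ᵇ 0) (sites (len D))

nfree : Diagram → ℕ
nfree D = length (freeSites D)

Covers : Arc → ℕ → Set
Covers (a , b) s = a < s × s < b

IsProper : Diagram → Set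
IsProper D = IsBinary D
  × (∀ α → α ∈ arcs D → ∃ λ s → IsFree D s × Covers α s)
  × (∀ α → α ∈ arcs D → ∃ λ s → IsFree D s × (Covers α s → Data.Empty.⊥))
  where import Data.Empty

Cross : Arc → Arc → Set
Cross (a , b) (c , d) = (a < c × c < b × b < d) ⊎ (c < a × a < d × d < b)

KNoncrossing : ℕ → Diagram → Set
KNoncrossing k D = ∀ (L : List Arc) → All (_∈ arcs D) L → AllPairs Cross L → length L ≤ k

-- 0-based block index: site s (not free) lies in block B_{i+1} (paper's
-- numbering) where i = number of free sites smaller than s.
blk : Diagram → ℕ → ℕ
blk D s = length (filterᵇ (λ u → u <ᵇ s) (freeSites D))

-- entry b_{i,j} of the block matrix (0-based indices 0 … f)
bmat : Diagram → ℕ → ℕ → ℕ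
bmat D i j = length (filterᵇ p (arcs D))
  where
  p : Arc → Bool
  p (x , y) = ((blk D x ≡ᵇ i) ∧ (blk D y ≡ᵇ j)) ∨ ((blk D x ≡ᵇ j) ∧ (blk D y ≡ᵇ i))

tautology : Diagram → ℕ
tautology D =
  sum (concatMap (λ j → map (λ i → bmat D i j ∸ 1) (upTo j)) (upTo (suc f)))
  + sum (map (λ i → bmat D i (suc i)) (upTo f))
  where
  f = nfree D

IsRegular : Diagram → Set
IsRegular D = IsBinary D ×
  (∀ α β → α ∈ arcs D → β ∈ arcs D → Cross α β →
     ∀ x y → Supports x α → Supports y β → blk D x ≢ blk D y)

InP : ℕ → ℕ → ℕ → Diagram → Set
InP r f k D = IsProper D × nfree D ≡ f × KNoncrossing k D × tautology D ≤ r

InR : ℕ → ℕ → ℕ → Diagram → Set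
InR r f k D = InP r f k D × IsRegular D

suppress : Arc → Diagram → Diagram
suppress (a , b) D = mkD (len D ∸ 2) (map relab (filterᵇ keep (arcs D)))
  where
  keep : Arc → Bool
  keep (x , y) = not ((x ≡ᵇ a) ∧ (y ≡ᵇ b))
  shift : ℕ → ℕ
  shift s = s ∸ length (filterᵇ (λ t → t <ᵇ s) (a Data.List.∷ b Data.List.∷ []))
  relab : Arc → Arc
  relab (x , y) = (shift x , shift y)

Step : Diagram → Diagram → Set
Step S S' = ∃ λ α → α ∈ arcs S' × S ≡ suppress α S'

_⪯_ : Diagram → Diagram → Set
S ⪯ S' = Star Step S S'

-- Suppressing an arc deletes it, so every suppression step strictly decreases the number of
-- arcs and ⪯ is antisymmetric on any set of diagrams. For finiteness, every arc of a proper
-- diagram covers a free site and therefore joins two distinct blocks; one arc per pair of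
-- blocks is free of charge, and every further arc adds to the tautology number. So a diagram
-- in 𝒫^r_{f,k} has at most r + (f+1)f/2 arcs, and being binary, at most f + 2(r + (f+1)f/2)
-- sites. Non-emptiness is witnessed by a single arc: (1,3) on 4 sites when f = 2 (tautology
-- number 1 ≤ r), and (1,4) on f + 2 sites when f ≥ 3 (tautology number 0).

module Submission where

open import Defs
open import Data.Nat using (ℕ; zero; suc; _+_; _*_; _∸_; _≤_; _<_; _≡ᵇ_; _<ᵇ_; z≤n; s≤s)
open import Data.Nat.Properties
open import Data.Nat.ListAction using (sum)
open import Data.Bool using (Bool; true; false; T; _∧_; _∨_; not)
open import Data.Bool.Properties using (T-∧; T-∨)
open import Data.Bool.ListAction using (any)
open import Data.List
  using (List; []; _∷_; length; map; upTo; applyUpTo; concatMap; filterᵇ; cartesianProduct; cartesianProductWith)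
open import Data.List.Properties
  using (length-map; length-upTo; length-applyUpTo; length-filter; map-∘; map-concatMap; concatMap-cong;
         filter-notAll; filter-all; filter-none; filter-accept; filter-reject)
open import Data.List.Membership.Propositional using (_∈_)
open import Data.List.Membership.Propositional.Properties
  using (∈-map⁺; ∈-upTo⁺; ∈-concatMap⁺; ∈-filter⁺; ∈-cartesianProduct⁺; ∈-cartesianProductWith⁺)
open import Data.List.Relation.Unary.Any using (here; there)
import Data.List.Relation.Unary.Any as Any
open import Data.List.Relation.Unary.All using (All; []; _∷_)
import Data.List.Relation.Unary.All as All
open import Data.List.Relation.Unary.All.Properties using (map⁺; concat⁺; applyUpTo⁺₂)
open import Data.List.Relation.Unary.AllPairs using ([]; _∷_)
open import Data.List.Relation.Unary.Unique.Propositional using (Unique)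
import Data.List.Relation.Unary.Unique.Propositional.Properties as Unique
open import Data.List.Relation.Binary.Sublist.Propositional using (⊆-refl)
open import Data.List.Relation.Binary.Sublist.Propositional.Properties using (filter⁺; length-mono-≤)
open import Data.Product using (Σ; ∃; _×_; _,_; proj₁; proj₂)
open import Data.Sum using (_⊎_; inj₁; inj₂)
open import Data.Empty using (⊥-elim)
open import Data.Unit using (tt)
open import Function using (_∘_; _on_; Equivalence)
open import Relation.Nullary using (¬_; contradiction)
open import Relation.Nullary.Decidable using (T?)
open import Relation.Binary.Structures using (IsPartialOrder)
open import Relation.Binary.PropositionalEquality
open import Relation.Binary.Construct.Closure.ReflexiveTransitive using (ε; _◅_; _◅◅_)
open import Algebra.Properties.CommutativeSemigroup +-commutativeSemigroup using (interchange)

private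
  variable
    A Q : Set

length-filterᵇ-partition : (p : A → Bool) (xs : List A) →
  length xs ≡ length (filterᵇ p xs) + length (filterᵇ (not ∘ p) xs)
length-filterᵇ-partition p [] = refl
length-filterᵇ-partition p (x ∷ xs) with ih ← length-filterᵇ-partition p xs | p x
... | true  = cong suc ih
... | false = trans (cong suc ih) (sym (+-suc _ _))

length-filterᵇ-∨ : (p q : A → Bool) (xs : List A) →
  length (filterᵇ (λ x → p x ∨ q x) xs) ≤ length (filterᵇ p xs) + length (filterᵇ q xs)
length-filterᵇ-∨ p q [] = z≤n
length-filterᵇ-∨ p q (x ∷ xs) with ih ← length-filterᵇ-∨ p q xs | p x | q x
... | true  | true  = s≤s (≤-trans ih (+-monoʳ-≤ _ (n≤1+n _)))
... | true  | false = s≤s ih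
... | false | true  = ≤-trans (s≤s ih) (≤-reflexive (sym (+-suc _ _)))
... | false | false = ih

length-filterᵇ-mono : (p q : A → Bool) → (∀ x → T (p x) → T (q x)) → ∀ xs →
  length (filterᵇ p xs) ≤ length (filterᵇ q xs)
length-filterᵇ-mono p q p⇒q xs =
  length-mono-≤ (filter⁺ (T? ∘ p) (T? ∘ q) (λ { refl → p⇒q _ }) (⊆-refl {x = xs}))

length-filterᵇ-mono-< : (p q : A → Bool) → (∀ x → T (p x) → T (q x)) →
  ∀ {s xs} → s ∈ xs → ¬ T (p s) → T (q s) → length (filterᵇ p xs) < length (filterᵇ q xs)
length-filterᵇ-mono-< p q p⇒q {xs = x ∷ xs} (here refl) ¬ps qs with p x | q x
... | false | true = s≤s (length-filterᵇ-mono p q p⇒q xs)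
... | true  | _    = contradiction tt ¬ps
length-filterᵇ-mono-< p q p⇒q {xs = x ∷ xs} (there s∈xs) ¬ps qs
  with ih ← length-filterᵇ-mono-< p q p⇒q s∈xs ¬ps qs | p x in px | q x in qx
... | true  | true  = s≤s ih
... | true  | false = ⊥-elim (subst T qx (p⇒q x (subst T (sym px) tt)))
... | false | true  = m<n⇒m<1+n ih
... | false | false = ih

length-filterᵇ≢0 : (p : A → Bool) (xs : List A) → not (length (filterᵇ p xs) ≡ᵇ 0) ≡ any p xs
length-filterᵇ≢0 p [] = refl
length-filterᵇ≢0 p (x ∷ xs) with p x
... | true  = refl
... | false = length-filterᵇ≢0 p xs

Unique⇒length-filterᵇ-≡ᵇ≤1 : ∀ a {xs} → Unique xs → length (filterᵇ (_≡ᵇ a) xs) ≤ 1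
Unique⇒length-filterᵇ-≡ᵇ≤1 a [] = z≤n
Unique⇒length-filterᵇ-≡ᵇ≤1 a {x ∷ xs} (x∉xs ∷ u) with x ≡ᵇ a in x≡a
... | false = Unique⇒length-filterᵇ-≡ᵇ≤1 a u
... | true  = s≤s (≤-reflexive (cong length (filter-none (T? ∘ (_≡ᵇ a)) (All.map ≢a x∉xs))))
  where
  ≢a : ∀ {y} → x ≢ y → ¬ T (y ≡ᵇ a)
  ≢a x≢y y≡a = x≢y (trans (≡ᵇ⇒≡ x a (subst T (sym x≡a) tt)) (sym (≡ᵇ⇒≡ _ a y≡a)))

length-filterᵇ≤length-filterᵇ-∷ : (p : A → Bool) (x : A) (xs : List A) →
  length (filterᵇ p xs) ≤ length (filterᵇ p (x ∷ xs))
length-filterᵇ≤length-filterᵇ-∷ p x xs with p x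
... | true  = n≤1+n _
... | false = ≤-refl

sum-map-mono-≤ : {f g : Q → ℕ} → (∀ q → f q ≤ g q) → ∀ P → sum (map f P) ≤ sum (map g P)
sum-map-mono-≤ f≤g []      = z≤n
sum-map-mono-≤ f≤g (q ∷ P) = +-mono-≤ (f≤g q) (sum-map-mono-≤ f≤g P)

sum-map-mono-< : {f g : Q → ℕ} → (∀ q → f q ≤ g q) →
  ∀ {q P} → q ∈ P → f q < g q → sum (map f P) < sum (map g P)
sum-map-mono-< f≤g {P = _ ∷ P} (here refl) fq<gq = +-mono-<-≤ fq<gq (sum-map-mono-≤ f≤g P)
sum-map-mono-< f≤g {P = p ∷ _} (there q∈P) fq<gq =
  +-mono-≤-< (f≤g p) (sum-map-mono-< f≤g q∈P fq<gq)

sum-map≤length+sum-map-pred : (h : Q → ℕ) (P : List Q) →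
  sum (map h P) ≤ length P + sum (map (λ q → h q ∸ 1) P)
sum-map≤length+sum-map-pred h []      = z≤n
sum-map≤length+sum-map-pred h (q ∷ P) = begin
  h q + sum (map h P)
    ≤⟨ +-mono-≤ (m≤n+m∸n (h q) 1) (sum-map≤length+sum-map-pred h P) ⟩
  (1 + (h q ∸ 1)) + (length P + sum (map (λ q → h q ∸ 1) P))
    ≡⟨ interchange 1 (h q ∸ 1) (length P) _ ⟩
  suc (length P) + sum (map (λ q → h q ∸ 1) (q ∷ P))
    ∎
  where open ≤-Reasoning

sum≡0 : ∀ {ns} → All (_≡ 0) ns → sum ns ≡ 0
sum≡0 []           = refl
sum≡0 (refl ∷ zs) = sum≡0 zs

length≤sum-length-filterᵇ : (c : Q → A → Bool) (P : List Q) (xs : List A) →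
  (∀ {x} → x ∈ xs → ∃ λ q → q ∈ P × T (c q x)) →
  length xs ≤ sum (map (λ q → length (filterᵇ (c q) xs)) P)
length≤sum-length-filterᵇ c P []       covered = z≤n
length≤sum-length-filterᵇ c P (x ∷ xs) covered with q , q∈P , cqx ← covered (here refl) =
  ≤-trans (s≤s (length≤sum-length-filterᵇ c P xs (covered ∘ there)))
          (sum-map-mono-< (λ q → length-filterᵇ≤length-filterᵇ-∷ (c q) x xs) q∈P
                          (≤-reflexive (cong length (sym (filter-accept (T? ∘ c q) cqx)))))

suppress-length-< : ∀ {α S} → α ∈ arcs S → length (arcs (suppress α S)) < length (arcs S)
suppress-length-< {a , b} {S} α∈S =
  subst (_< length (arcs S)) (sym (length-map _ (filterᵇ _ (arcs S))))
    (filter-notAll (T? ∘ _) (arcs S) (Any.map (λ { refl → rejected }) α∈S))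
  where
  rejected : ¬ T (not ((a ≡ᵇ a) ∧ (b ≡ᵇ b)))
  rejected with a ≡ᵇ a | ≡⇒≡ᵇ a a refl | b ≡ᵇ b | ≡⇒≡ᵇ b b refl
  ... | true | _ | true | _ = λ ()

⪯⇒length≤ : ∀ {S S'} → S ⪯ S' → length (arcs S) ≤ length (arcs S')
⪯⇒length≤ ε = ≤-refl
⪯⇒length≤ (_◅_ {j = S₁} (_ , α∈S₁ , refl) S⪯S') =
  ≤-trans (<⇒≤ (suppress-length-< {S = S₁} α∈S₁)) (⪯⇒length≤ S⪯S')

⪯-antisym : ∀ {S S'} → S ⪯ S' → S' ⪯ S → S ≡ S'
⪯-antisym ε _ = refl
⪯-antisym (_◅_ {j = S₁} (_ , α∈S₁ , refl) S⪯S') S'⪯S =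
  contradiction (⪯⇒length≤ S'⪯S)
    (<⇒≱ (<-≤-trans (suppress-length-< {S = S₁} α∈S₁) (⪯⇒length≤ S⪯S')))

⪯-isPartialOrder : (P : Diagram → Set) →
  IsPartialOrder {A = Σ Diagram P} (_≡_ on proj₁) (_⪯_ on proj₁)
⪯-isPartialOrder P = record
  { isPreorder = record
    { isEquivalence = record { refl = refl ; sym = sym ; trans = trans }
    ; reflexive     = λ { refl → ε }
    ; trans         = _◅◅_
    }
  ; antisym = ⪯-antisym
  }

Unique⇒length-filterᵇ-supported≤ : ∀ (As : List Arc) {xs} → Unique xs →
  length (filterᵇ (λ s → any (supportsᵇ s) As) xs) ≤ 2 * length As
Unique⇒length-filterᵇ-supported≤ [] {xs} _ =
  ≤-reflexive (cong length (filter-none (T? ∘ _) (All.universal (λ _ ()) xs)))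
Unique⇒length-filterᵇ-supported≤ ((a , b) ∷ As) {xs} u = begin
  length (filterᵇ (λ s → supportsᵇ s (a , b) ∨ any (supportsᵇ s) As) xs)
    ≤⟨ length-filterᵇ-∨ (λ s → supportsᵇ s (a , b)) _ xs ⟩
  length (filterᵇ (λ s → supportsᵇ s (a , b)) xs) + length (filterᵇ (λ s → any (supportsᵇ s) As) xs)
    ≤⟨ +-mono-≤ (length-filterᵇ-∨ (_≡ᵇ a) (_≡ᵇ b) xs) (Unique⇒length-filterᵇ-supported≤ As u) ⟩
  (length (filterᵇ (_≡ᵇ a) xs) + length (filterᵇ (_≡ᵇ b) xs)) + 2 * length As
    ≤⟨ +-monoˡ-≤ _ (+-mono-≤ (Unique⇒length-filterᵇ-≡ᵇ≤1 a u) (Unique⇒length-filterᵇ-≡ᵇ≤1 b u)) ⟩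
  2 + 2 * length As
    ≡⟨ *-suc 2 (length As) ⟨
  2 * length ((a , b) ∷ As) ∎
  where open ≤-Reasoning

len≤nfree+2*length-arcs : ∀ D → len D ≤ nfree D + 2 * length (arcs D)
len≤nfree+2*length-arcs D = begin
  len D
    ≡⟨ trans (length-map suc (upTo (len D))) (length-upTo (len D)) ⟨
  length (sites (len D))
    ≡⟨ length-filterᵇ-partition isFreeᵇ (sites (len D)) ⟩
  nfree D + length (filterᵇ (not ∘ isFreeᵇ) (sites (len D)))
    ≤⟨ +-monoʳ-≤ (nfree D) (length-filterᵇ-mono _ _ nonFree⇒supported (sites (len D))) ⟩
  nfree D + length (filterᵇ (λ s → any (supportsᵇ s) (arcs D)) (sites (len D)))
    ≤⟨ +-monoʳ-≤ (nfree D) (Unique⇒length-filterᵇ-supported≤ (arcs D) sites-unique) ⟩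
  nfree D + 2 * length (arcs D)
    ∎
  where
  open ≤-Reasoning
  sites-unique : Unique (sites (len D))
  sites-unique = Unique.map⁺ suc-injective (Unique.upTo⁺ (len D))
  nonFree⇒supported : ∀ s → T (not (deg D s ≡ᵇ 0)) → T (any (supportsᵇ s) (arcs D))
  nonFree⇒supported s = subst T (length-filterᵇ≢0 (supportsᵇ s) (arcs D))
  isFreeᵇ : ℕ → Bool
  isFreeᵇ s = deg D s ≡ᵇ 0

-- The predicate counted by bmat D i j; the two agree definitionally.
inBlocksᵇ : Diagram → ℕ × ℕ → Arc → Bool
inBlocksᵇ D (i , j) (x , y) = ((blk D x ≡ᵇ i) ∧ (blk D y ≡ᵇ j)) ∨ ((blk D x ≡ᵇ j) ∧ (blk D y ≡ᵇ i))

inBlocksᵇ-blk : ∀ D x y → T (inBlocksᵇ D (blk D x , blk D y) (x , y))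
inBlocksᵇ-blk D x y
  with blk D x ≡ᵇ blk D x | ≡⇒≡ᵇ (blk D x) _ refl | blk D y ≡ᵇ blk D y | ≡⇒≡ᵇ (blk D y) _ refl
... | true | _ | true | _ = tt

inBlocksᵇ-sound : ∀ D i j x y → T (inBlocksᵇ D (i , j) (x , y)) →
  (blk D x ≡ i × blk D y ≡ j) ⊎ (blk D x ≡ j × blk D y ≡ i)
inBlocksᵇ-sound D i j x y t with Equivalence.to (T-∨ {(blk D x ≡ᵇ i) ∧ (blk D y ≡ᵇ j)}) t
... | inj₁ t₁ = let xi , yj = Equivalence.to (T-∧ {blk D x ≡ᵇ i}) t₁
               in inj₁ (≡ᵇ⇒≡ _ i xi , ≡ᵇ⇒≡ _ j yj)
... | inj₂ t₂ = let xj , yi = Equivalence.to (T-∧ {blk D x ≡ᵇ j}) t₂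
               in inj₂ (≡ᵇ⇒≡ _ j xj , ≡ᵇ⇒≡ _ i yi)

IsFree⇒∈freeSites : ∀ {D s} → IsFree D s → s ∈ freeSites D
IsFree⇒∈freeSites {D} {suc s} (_ , s<len , deg≡0) =
  ∈-filter⁺ (T? ∘ _) (∈-map⁺ suc (∈-upTo⁺ s<len)) (≡⇒≡ᵇ (deg D (suc s)) 0 deg≡0)

blk-<-across-free : ∀ D {x y s} → IsFree D s → x < s → s < y → blk D x < blk D y
blk-<-across-free D {x} {y} free x<s s<y =
  length-filterᵇ-mono-< (_<ᵇ x) (_<ᵇ y)
    (λ u u<x → <⇒<ᵇ (<-trans (<ᵇ⇒< u x u<x) (<-trans x<s s<y)))
    (IsFree⇒∈freeSites {D} free) (λ s<x → <-asym x<s (<ᵇ⇒< _ x s<x)) (<⇒<ᵇ s<y)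

blk≤nfree : ∀ D y → blk D y ≤ nfree D
blk≤nfree D y = length-filter (T? ∘ (_<ᵇ y)) (freeSites D)

blockPairs : ℕ → List (ℕ × ℕ)
blockPairs f = concatMap (λ j → map (_, j) (upTo j)) (upTo (suc f))

∈-blockPairs : ∀ {f i j} → i < j → j ≤ f → (i , j) ∈ blockPairs f
∈-blockPairs {i = i} {j} i<j j≤f = ∈-concatMap⁺ (λ j → map (_, j) (upTo j))
  (Any.map (λ { refl → ∈-map⁺ (_, j) (∈-upTo⁺ i<j) }) (∈-upTo⁺ (s≤s j≤f)))

map-blockPairs : (g : ℕ → ℕ → ℕ) (f : ℕ) →
  map (λ q → g (proj₁ q) (proj₂ q)) (blockPairs f)
    ≡ concatMap (λ j → map (λ i → g i j) (upTo j)) (upTo (suc f))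
map-blockPairs g f =
  trans (map-concatMap g′ (λ j → map (_, j) (upTo j)) (upTo (suc f)))
        (concatMap-cong (λ j → sym (map-∘ {g = g′} {f = _, j} (upTo j))) (upTo (suc f)))
  where
  g′ : ℕ × ℕ → ℕ
  g′ q = g (proj₁ q) (proj₂ q)

length-arcs≤ : ∀ {r f k D} → InP r f k D → length (arcs D) ≤ length (blockPairs f) + r
length-arcs≤ {r} {D = D} ((_ , covers , _) , refl , _ , tautology≤r) = begin
  length (arcs D)
    ≤⟨ length≤sum-length-filterᵇ (inBlocksᵇ D) P (arcs D) inSomeBlockPair ⟩
  sum (map b P)
    ≤⟨ sum-map≤length+sum-map-pred b P ⟩
  length P + sum (map (λ q → b q ∸ 1) P)
    ≡⟨ cong (λ t → length P + sum t) (map-blockPairs (λ i j → bmat D i j ∸ 1) (nfree D)) ⟩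
  length P + sum (concatMap (λ j → map (λ i → bmat D i j ∸ 1) (upTo j)) (upTo (suc (nfree D))))
    ≤⟨ +-monoʳ-≤ (length P) (≤-trans (m≤m+n _ _) tautology≤r) ⟩
  length P + r
    ∎
  where
  open ≤-Reasoning
  P = blockPairs (nfree D)
  b : ℕ × ℕ → ℕ
  b (i , j) = bmat D i j
  inSomeBlockPair : ∀ {α} → α ∈ arcs D → ∃ λ q → q ∈ P × T (inBlocksᵇ D q α)
  inSomeBlockPair {x , y} α∈D with s , free , x<s , s<y ← covers _ α∈D =
    (blk D x , blk D y) ,
    ∈-blockPairs {nfree D} (blk-<-across-free D free x<s s<y) (blk≤nfree D y) ,
    inBlocksᵇ-blk D x y

listsOfLength≤ : ℕ → List A → List (List A)
listsOfLength≤ zero    xs = [] ∷ []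
listsOfLength≤ (suc m) xs = [] ∷ cartesianProductWith _∷_ xs (listsOfLength≤ m xs)

∈-listsOfLength≤ : ∀ {m} {xs : List A} ys → length ys ≤ m → All (_∈ xs) ys → ys ∈ listsOfLength≤ m xs
∈-listsOfLength≤ {m = zero}  []       _            _                = here refl
∈-listsOfLength≤ {m = suc m} []       _            _                = here refl
∈-listsOfLength≤ {m = suc m} (y ∷ ys) (s≤s ys≤m) (y∈xs ∷ ys⊆xs) =
  there (∈-cartesianProductWith⁺ _∷_ y∈xs (∈-listsOfLength≤ ys ys≤m ys⊆xs))

diagramsWithin : ℕ → ℕ → List Diagram
diagramsWithin N M =
  cartesianProductWith mkD (upTo (suc N)) (listsOfLength≤ M (cartesianProduct (upTo (suc N)) (upTo (suc N))))

∈-diagramsWithin : ∀ {N M} D → All (ArcOK (len D)) (arcs D) → len D ≤ N → length (arcs D) ≤ M →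
  D ∈ diagramsWithin N M
∈-diagramsWithin {N} D arcsOK len≤N arcs≤M =
  ∈-cartesianProductWith⁺ mkD (∈-upTo⁺ (s≤s len≤N))
    (∈-listsOfLength≤ (arcs D) arcs≤M (All.map inRange arcsOK))
  where
  inRange : ∀ {α} → ArcOK (len D) α → α ∈ cartesianProduct (upTo (suc N)) (upTo (suc N))
  inRange (_ , a<b , b≤len , _) =
    ∈-cartesianProduct⁺ (∈-upTo⁺ (s≤s (≤-trans (<⇒≤ a<b) b≤N))) (∈-upTo⁺ (s≤s b≤N))
    where b≤N = ≤-trans b≤len len≤N

InP-finite : ∀ r f k → Σ (List Diagram) λ L → ∀ D → InP r f k D → D ∈ L
InP-finite r f k = diagramsWithin (f + 2 * M) M ,
  λ D D∈P → ∈-diagramsWithin D (arcsOK D∈P) (len≤ D D∈P) (length-arcs≤ D∈P)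
  where
  M = length (blockPairs f) + r
  arcsOK : ∀ {D} → InP r f k D → All (ArcOK (len D)) (arcs D)
  arcsOK ((((_ , ok) , _) , _) , _) = ok
  len≤ : ∀ D → InP r f k D → len D ≤ f + 2 * M
  len≤ D D∈P@(_ , refl , _) =
    ≤-trans (len≤nfree+2*length-arcs D) (+-monoʳ-≤ f (*-monoʳ-≤ 2 (length-arcs≤ D∈P)))

oneArc : ℕ → Arc → Diagram
oneArc n α = mkD n (α ∷ [])

Cross-irrefl : ∀ α → ¬ Cross α α
Cross-irrefl _ (inj₁ (a<a , _)) = <-irrefl refl a<a
Cross-irrefl _ (inj₂ (a<a , _)) = <-irrefl refl a<a

oneArc-noncrossing : ∀ {k n α} → 1 ≤ k → KNoncrossing k (oneArc n α)
oneArc-noncrossing 1≤k []          _                           _               = z≤n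
oneArc-noncrossing 1≤k (_ ∷ [])    _                           _               = 1≤k
oneArc-noncrossing 1≤k (_ ∷ _ ∷ _) (here refl ∷ here refl ∷ _) ((α×α ∷ _) ∷ _) =
  ⊥-elim (Cross-irrefl _ α×α)

oneArc-isProper : ∀ {n α s t} → ArcOK n α →
  IsFree (oneArc n α) s → Covers α s → IsFree (oneArc n α) t → ¬ Covers α t → IsProper (oneArc n α)
oneArc-isProper ok free-s covers free-t ¬covers =
  ((([] ∷ []) , (ok ∷ [])) , (λ ()) , (λ s → length-filter (T? ∘ supportsᵇ s) (_ ∷ []))) ,
  (λ { _ (here refl) → _ , free-s , covers }) ,
  (λ { _ (here refl) → _ , free-t , ¬covers })

oneArc-tautology≡0 : ∀ {n a b} → let D = oneArc n (a , b) in suc (blk D a) < blk D b → tautology D ≡ 0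
oneArc-tautology≡0 {n} {a} {b} separated = cong₂ _+_
  (sum≡0 (concat⁺ (map⁺ (All.universal excesses≡0 (upTo (suc (nfree D)))))))
  (sum≡0 (map⁺ (All.universal adjacent≡0 (upTo (nfree D)))))
  where
  D = oneArc n (a , b)
  excess≡0 : ∀ i j → bmat D i j ∸ 1 ≡ 0
  excess≡0 i j = m≤n⇒m∸n≡0 (length-filter (T? ∘ inBlocksᵇ D (i , j)) ((a , b) ∷ []))
  excesses≡0 : ∀ j → All (_≡ 0) (map (λ i → bmat D i j ∸ 1) (upTo j))
  excesses≡0 j = map⁺ (All.universal (λ i → excess≡0 i j) (upTo j))
  notAdjacent : ∀ i → ¬ T (inBlocksᵇ D (i , suc i) (a , b))
  notAdjacent i t with inBlocksᵇ-sound D i (suc i) a b t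
  ... | inj₁ (refl , b≡1+a) = <-irrefl (sym b≡1+a) separated
  ... | inj₂ (a≡1+b , refl) =
    <⇒≱ separated (≤-trans (n≤1+n _) (≤-trans (≤-reflexive (sym a≡1+b)) (n≤1+n _)))
  adjacent≡0 : ∀ i → bmat D i (suc i) ≡ 0
  adjacent≡0 i = cong length (filter-reject (T? ∘ inBlocksᵇ D (i , suc i)) (notAdjacent i))

witness₂ : Diagram
witness₂ = oneArc 4 (1 , 3)

witness₂∈P : ∀ {r k} → 1 ≤ r → 1 ≤ k → InP r 2 k witness₂
witness₂∈P 1≤r 1≤k =
  oneArc-isProper {4} {1 , 3} {2} {4} (s≤s z≤n , s≤s (s≤s z≤n) , n≤1+n 3 , ≤-refl , ≤-refl)
    (s≤s z≤n , s≤s (s≤s z≤n) , refl) (≤-refl , ≤-refl)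
    (s≤s z≤n , ≤-refl , refl) (λ { (_ , 4<3) → <-asym 4<3 (s≤s ≤-refl) }) ,
  refl , oneArc-noncrossing {n = 4} {1 , 3} 1≤k , 1≤r

-- Free sites 2, 3, 5, 6, …, 5 + m; the arc joins the blocks {1} and {4}, which are not adjacent.
witness₃₊ : ℕ → Diagram
witness₃₊ m = oneArc (5 + m) (1 , 4)

freeSites-witness₃₊ : ∀ m → freeSites (witness₃₊ m) ≡ 2 ∷ 3 ∷ 5 ∷ map suc (applyUpTo (5 +_) m)
freeSites-witness₃₊ m =
  cong (λ us → 2 ∷ 3 ∷ 5 ∷ us) (filter-all (T? ∘ _) (map⁺ (applyUpTo⁺₂ _ m (λ _ → tt))))

filterᵇ-<ᵇ-late-sites : ∀ m {x} → x ≤ 6 → filterᵇ (_<ᵇ x) (map suc (applyUpTo (5 +_) m)) ≡ []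
filterᵇ-<ᵇ-late-sites m x≤6 = filter-none (T? ∘ _)
  (map⁺ (applyUpTo⁺₂ _ m (λ i 6+i<x → <⇒≱ (<ᵇ⇒< _ _ 6+i<x) (≤-trans x≤6 (m≤m+n 6 i)))))

blk-witness₃₊ : ∀ m → blk (witness₃₊ m) 1 ≡ 0 × blk (witness₃₊ m) 4 ≡ 2
blk-witness₃₊ m =
  trans (cong (length ∘ filterᵇ (_<ᵇ 1)) (freeSites-witness₃₊ m))
        (cong length (filterᵇ-<ᵇ-late-sites m (s≤s z≤n))) ,
  trans (cong (length ∘ filterᵇ (_<ᵇ 4)) (freeSites-witness₃₊ m))
        (cong (λ us → 2 + length us) (filterᵇ-<ᵇ-late-sites m (m≤m+n 4 2)))

nfree-witness₃₊ : ∀ m → nfree (witness₃₊ m) ≡ 3 + m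
nfree-witness₃₊ m = begin
  length (freeSites (witness₃₊ m))           ≡⟨ cong length (freeSites-witness₃₊ m) ⟩
  3 + length (map suc (applyUpTo (5 +_) m))  ≡⟨ cong (3 +_) (length-map suc (applyUpTo (5 +_) m)) ⟩
  3 + length (applyUpTo (5 +_) m)            ≡⟨ cong (3 +_) (length-applyUpTo (5 +_) m) ⟩
  3 + m                                      ∎
  where open ≡-Reasoning

witness₃₊∈P : ∀ {r k} m → 1 ≤ k → InP r (3 + m) k (witness₃₊ m)
witness₃₊∈P m 1≤k =
  oneArc-isProper {5 + m} {1 , 4} {2} {5}
    (s≤s z≤n , s≤s (s≤s z≤n) , m≤m+n 4 (1 + m) , s≤s (s≤s z≤n) , m≤m+n 4 m)
    (s≤s z≤n , s≤s (s≤s z≤n) , refl) (≤-refl , n≤1+n 3)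
    (s≤s z≤n , m≤m+n 5 m , refl) (λ { (_ , 5<4) → <-asym 5<4 (s≤s ≤-refl) }) ,
  nfree-witness₃₊ m , oneArc-noncrossing {n = 5 + m} {1 , 4} 1≤k ,
  ≤-trans (≤-reflexive (oneArc-tautology≡0 {5 + m} {1} {4} blocks-separated)) z≤n
  where
  blocks-separated : suc (blk (witness₃₊ m) 1) < blk (witness₃₊ m) 4
  blocks-separated with blk (witness₃₊ m) 1 | blk (witness₃₊ m) 4 | blk-witness₃₊ m
  ... | _ | _ | refl , refl = s≤s (s≤s ≤-refl)

InP-nonempty : ∀ f r k → 2 ≤ f → 1 ≤ k → 3 ≤ f + r → ∃ (InP r f k)
InP-nonempty 1                   r k (s≤s ()) _   _
InP-nonempty 2                   r k _        1≤k (s≤s (s≤s 1≤r)) = witness₂ , witness₂∈P 1≤r 1≤k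
InP-nonempty (suc (suc (suc m))) r k _        1≤k _               = witness₃₊ m , witness₃₊∈P m 1≤k

proposition4p2 : ∀ (f r k : ℕ) → 2 ≤ f → 1 ≤ k → 3 ≤ f + r →
    (∃ λ S → InP r f k S)
    × (Σ (List Diagram) λ L → ∀ S → InP r f k S → S ∈ L)
    × IsPartialOrder {A = Σ Diagram (InP r f k)} (_≡_ on proj₁) (_⪯_ on proj₁)
    × (∀ S → InR r f k S → InP r f k S)
    × IsPartialOrder {A = Σ Diagram (InR r f k)} (_≡_ on proj₁) (_⪯_ on proj₁)
proposition4p2 f r k 2≤f 1≤k 3≤f+r =
  InP-nonempty f r k 2≤f 1≤k 3≤f+r ,
  InP-finite r f k ,
  ⪯-isPartialOrder (InP r f k) ,
  (λ _ → proj₁) ,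
  ⪯-isPartialOrder (InR r f k)
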